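{- Let $k\ge 3$ be odd and let $H$ be a Kimura Hadamard matrix of order $8k+4$. Let $p_k$ be the $k\times k$ permutation matrix of the cycle $(1,2,\dots,k)$, $E=\mathrm{diag}(p_k,p_k)$ and $F=\mathrm{diag}(I_4,E,E,E,E)$. Let $q_k$ be the $k\times k$ permutation matrix of $(2,k)(3,k-1)\cdots(\tfrac{k+1}{2},\tfrac{k+3}{2})$, $K=\mathrm{bdiag}(q_k,q_k)$ and $L=\mathrm{diag}(I_4,K,K,K,K)$. Then $\sigma_1=(F,F)$ is a strong automorphism of $H$ of order $k$, $\sigma_2=(L,L)$ is a strong automorphism of $H$ of order $2$, and the subgroup $\langle\sigma_1,\sigma_2\rangle$ of $\mathrm{Aut}(H)$ is isomorphic to the dihedral group $D_{2k}$.
   Context: Let $k\geq 3$ be odd. $D_{2k}=\langle x,y\mid x^k=1,\ y^2=1,\ y^{ -1}xy=x^{ -1}\rangle$, with elements listed in the order $x^0,\dots,x^{k-1},y,xy,\dots,x^{k-1}y$, which indexes rows and columns of $2k\times2k$ matrices. $\rho(g)=[\delta_{ug,v}]_{u,v}$ is the right regular matrix representation, extended linearly to $\mathbb{Z}D_{2k}$; for $w\in\mathbb{Z}D_{2k}$ with coefficients in $\{0,1\}$ its associated $\pm1$-matrix is $2\rho(w)-J_{2k}$. A Kimura Hadamard matrix of order $8k+4$ is a matrix \[ H=\begin{bmatrix} 1& 1 & 1 & 1 & \mathbf{1} & \mathbf{1} & \mathbf{1} & \mathbf{1}\\ 1& 1 & -1 & -1 & \mathbf{1} & \mathbf{1}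 & -\mathbf{1} & -\mathbf{1}\\ 1& -1 & 1 & -1 & \mathbf{1} & -\mathbf{1} & \mathbf{1} & -\mathbf{1}\\ 1& -1 & -1 & 1 & -\mathbf{1} & \mathbf{1} & \mathbf{1} & -\mathbf{1}\\ \mathbf{1}^\intercal & \mathbf{1}^\intercal & \mathbf{1}^\intercal & -\mathbf{1}^\intercal & A & B& C & D\\ \mathbf{1}^\intercal & \mathbf{1}^\intercal& -\mathbf{1}^\intercal & \mathbf{1}^\intercal & -B & A & D & -C\\ \mathbf{1}^\intercal & -\mathbf{1}^\intercal& \mathbf{1}^\intercal & \mathbf{1}^\intercal & -C & -D & A & B\\ \mathbf{1}^\intercal & -\mathbf{1}^\intercal& -\mathbf{1}^\intercal & -\mathbf{1}^\intercal & D & -C & B & -A \end{bmatrix} \] ($\mathbf 1$ the all-ones row vector of length $2k$) with $HH^\intercal=(8k+4)I_{8k+4}$, where $A,B,C,D$ are the $\pm1$-matrices associated to some $a,b,c,d\in\mathbb{Z}D_{2k}$ with coefficients in $\{0,1\}$. With $\mathrm{Mon}_n(\{\pm1\})$ the group of $n\times n$ signed permutation matrices, $\mathrm{Aut}(H)=\{(R,S)\in\mathrm{Mon}_{8k+4}(\{\pm1\})^2: RHS^\intercal=H\}$ under componentwise multiplication; $(R,S)$ is strong if $R=S$. $\mathrm{diag}(Y_1,\dots,Y_n)$ is the block diagonal matrix and $\mathrm{bdiag}(Y_1,\dots,Y_n)$ the block anti-diagonal matrix with $Y_1,\dots,Y_n$ placed from top right to bottom left. -}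

module Defs where

open import Data.Nat as ℕ using (ℕ; zero; suc; _∸_; _%_; _≡ᵇ_)
open import Data.Nat.DivMod using (_mod_)
open import Data.Integer as ℤ using (ℤ; +_; -_; _+_; _*_; _-_)
open import Data.Fin as Fin using (Fin; zero; suc; toℕ; splitAt; remQuot; combine)
open import Data.Bool using (Bool; true; false; if_then_else_; _∧_; _∨_)
open import Data.Sum using (_⊎_; inj₁; inj₂)
open import Data.Product using (_×_; _,_; proj₁; proj₂; ∃)
open import Relation.Binary.PropositionalEquality using (_≡_; _≢_)
open import Relation.Nullary using (¬_)
open import Relation.Nullary.Decidable using (⌊_⌋)
open import Function using (_∘_)

Mat : ℕ → ℕ → Set
Mat m n = Fin m → Fin n → ℤ

∑ : ∀ {n} → (Fin n → ℤ) → ℤ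
∑ {zero}  f = + 0
∑ {suc n} f = f zero + ∑ (f ∘ suc)

_·M_ : ∀ {m n p} → Mat m n → Mat n p → Mat m p
(M ·M N) i j = ∑ (λ l → M i l * N l j)

infixl 7 _·M_

transpose : ∀ {m n} → Mat m n → Mat n m
transpose M i j = M j i

b2z : Bool → ℤ
b2z true  = + 1
b2z false = + 0

idM : ∀ {n} → Mat n n
idM i j = b2z ⌊ i Fin.≟ j ⌋

scal : ∀ {m n} → ℤ → Mat m n → Mat m n
scal c M i j = c * M i j

negM : ∀ {m n} → Mat m n → Mat m n
negM M i j = - M i j

onesM : ∀ {m n} → Mat m n
onesM i j = + 1

_≈M_ : ∀ {m n} → Mat m n → Mat m n → Set
M ≈M N = ∀ i j → M i j ≡ N i j

infix 4 _≈M_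

IsSignedPerm : ∀ {n} → Mat n n → Set
IsSignedPerm {n} M =
  (∀ i → ∃ λ j → (M i j ≡ + 1 ⊎ M i j ≡ - (+ 1)) × (∀ j' → j' ≢ j → M i j' ≡ + 0)) ×
  (∀ j → ∃ λ i → (M i j ≡ + 1 ⊎ M i j ≡ - (+ 1)) × (∀ i' → i' ≢ i → M i' j ≡ + 0))

permMat : ∀ {n} → (Fin n → Fin n) → Mat n n
permMat σ i j = b2z ⌊ j Fin.≟ σ i ⌋

diagBlocks : ∀ n {m} → Mat m m → Mat (n ℕ.* m) (n ℕ.* m)
diagBlocks n {m} X r c with remQuot {n} m r | remQuot {n} m c
... | (b , i) | (b' , j) = if ⌊ b Fin.≟ b' ⌋ then X i j else + 0

-- bdiag(X, ..., X) with n copies of X, placed from top right to bottom left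
antiDiagBlocks : ∀ n {m} → Mat m m → Mat (n ℕ.* m) (n ℕ.* m)
antiDiagBlocks n {m} X r c with remQuot {n} m r | remQuot {n} m c
... | (b , i) | (b' , j) = if (toℕ b ℕ.+ toℕ b' ≡ᵇ n ∸ 1) then X i j else + 0

directSum : ∀ {p q} → Mat p p → Mat q q → Mat (p ℕ.+ q) (p ℕ.+ q)
directSum {p} Y Z r c with splitAt p r | splitAt p c
... | inj₁ i | inj₁ j = Y i j
... | inj₁ i | inj₂ j = + 0
... | inj₂ i | inj₁ j = + 0
... | inj₂ i | inj₂ j = Z i j

-- The dihedral group D_{2k}; element index s*k + i (s ∈ {0,1}, i < k)
-- stands for x^i y^s, i.e. order x^0,...,x^{k-1},y,xy,...,x^{k-1}y.

addMod : ∀ {k} → Fin k → Fin k → Fin k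
addMod {suc m} i j = (toℕ i ℕ.+ toℕ j) mod suc m

negMod : ∀ {k} → Fin k → Fin k
negMod {suc m} j = (suc m ∸ toℕ j) mod suc m

xor2 : Fin 2 → Fin 2 → Fin 2
xor2 zero t = t
xor2 (suc zero) zero = suc zero
xor2 (suc zero) (suc zero) = zero

-- (x^i y^s)(x^j y^t) = x^{i + (-1)^s j} y^{s+t}
dmul : ∀ k → Fin (2 ℕ.* k) → Fin (2 ℕ.* k) → Fin (2 ℕ.* k)
dmul k u g with remQuot {2} k u | remQuot {2} k g
... | (zero , i)     | (t , j) = combine t (addMod i j)
... | (suc zero , i) | (t , j) = combine (xor2 (suc zero) t) (addMod i (negMod j))

ρ : ∀ k → Fin (2 ℕ.* k) → Mat (2 ℕ.* k) (2 ℕ.* k)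
ρ k g u v = b2z ⌊ dmul k u g Fin.≟ v ⌋

-- linear extension to ZD_{2k} for elements w with coefficients in {0,1}
ρw : ∀ k → (Fin (2 ℕ.* k) → Bool) → Mat (2 ℕ.* k) (2 ℕ.* k)
ρw k w u v = ∑ (λ g → b2z (w g) * ρ k g u v)

pmMat : ∀ k → (Fin (2 ℕ.* k) → Bool) → Mat (2 ℕ.* k) (2 ℕ.* k)
pmMat k w u v = + 2 * ρw k w u v - onesM u v

sgn : Bool → ℤ → ℤ
sgn true  z = z
sgn false z = - z

topLeft : Fin 4 → Fin 4 → Bool
topLeft zero _ = true
topLeft (suc zero) zero = true
topLeft (suc zero) (suc zero) = true
topLeft (suc zero) (suc (suc _)) = false
topLeft (suc (suc zero)) zero = true
topLeft (suc (suc zero)) (suc zero) = false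
topLeft (suc (suc zero)) (suc (suc zero)) = true
topLeft (suc (suc zero)) (suc (suc (suc zero))) = false
topLeft (suc (suc (suc zero))) zero = true
topLeft (suc (suc (suc zero))) (suc zero) = false
topLeft (suc (suc (suc zero))) (suc (suc zero)) = false
topLeft (suc (suc (suc zero))) (suc (suc (suc zero))) = true

topRight : Fin 4 → Fin 4 → Bool
topRight zero _ = true
topRight (suc zero) zero = true
topRight (suc zero) (suc zero) = true
topRight (suc zero) (suc (suc _)) = false
topRight (suc (suc zero)) zero = true
topRight (suc (suc zero)) (suc zero) = false
topRight (suc (suc zero)) (suc (suc zero)) = true
topRight (suc (suc zero)) (suc (suc (suc zero))) = false
topRight (suc (suc (suc zero))) zero = false
topRight (suc (suc (suc zero))) (suc zero) = true
topRight (suc (suc (suc zero))) (suc (suc zero)) = true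
topRight (suc (suc (suc zero))) (suc (suc (suc zero))) = false

bottomLeft : Fin 4 → Fin 4 → Bool
bottomLeft zero zero = true
bottomLeft zero (suc zero) = true
bottomLeft zero (suc (suc zero)) = true
bottomLeft zero (suc (suc (suc zero))) = false
bottomLeft (suc zero) zero = true
bottomLeft (suc zero) (suc zero) = true
bottomLeft (suc zero) (suc (suc zero)) = false
bottomLeft (suc zero) (suc (suc (suc zero))) = true
bottomLeft (suc (suc zero)) zero = true
bottomLeft (suc (suc zero)) (suc zero) = false
bottomLeft (suc (suc zero)) (suc (suc zero)) = true
bottomLeft (suc (suc zero)) (suc (suc (suc zero))) = true
bottomLeft (suc (suc (suc zero))) zero = true
bottomLeft (suc (suc (suc zero))) (suc _) = false

blockArr : ∀ {n} → (A B C D : Mat n n) → Fin 4 → Fin 4 → Mat n n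
blockArr A B C D zero zero = A
blockArr A B C D zero (suc zero) = B
blockArr A B C D zero (suc (suc zero)) = C
blockArr A B C D zero (suc (suc (suc zero))) = D
blockArr A B C D (suc zero) zero = negM B
blockArr A B C D (suc zero) (suc zero) = A
blockArr A B C D (suc zero) (suc (suc zero)) = D
blockArr A B C D (suc zero) (suc (suc (suc zero))) = negM C
blockArr A B C D (suc (suc zero)) zero = negM C
blockArr A B C D (suc (suc zero)) (suc zero) = negM D
blockArr A B C D (suc (suc zero)) (suc (suc zero)) = A
blockArr A B C D (suc (suc zero)) (suc (suc (suc zero))) = B
blockArr A B C D (suc (suc (suc zero))) zero = D
blockArr A B C D (suc (suc (suc zero))) (suc zero) = negM C
blockArr A B C D (suc (suc (suc zero))) (suc (suc zero)) = B
blockArr A B C D (suc (suc (suc zero))) (suc (suc (suc zero))) = negM A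

kimuraAssemble : ∀ {n} → (A B C D : Mat n n) → Mat (4 ℕ.+ 4 ℕ.* n) (4 ℕ.+ 4 ℕ.* n)
kimuraAssemble {n} A B C D r c with splitAt 4 r | splitAt 4 c
... | inj₁ i | inj₁ j = sgn (topLeft i j) (+ 1)
... | inj₁ i | inj₂ c' = sgn (topRight i (proj₁ (remQuot {4} n c'))) (+ 1)
... | inj₂ r' | inj₁ j = sgn (bottomLeft (proj₁ (remQuot {4} n r')) j) (+ 1)
... | inj₂ r' | inj₂ c' with remQuot {4} n r' | remQuot {4} n c'
...   | (bi , u) | (bj , v) = blockArr A B C D bi bj u v

kimuraH : ∀ k → (a b c d : Fin (2 ℕ.* k) → Bool) →
          Mat (4 ℕ.+ 4 ℕ.* (2 ℕ.* k)) (4 ℕ.+ 4 ℕ.* (2 ℕ.* k))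
kimuraH k a b c d = kimuraAssemble (pmMat k a) (pmMat k b) (pmMat k c) (pmMat k d)

IsHadamard : ∀ {n} → Mat n n → Set
IsHadamard {n} H = H ·M transpose H ≈M scal (+ n) idM

Pair : ℕ → Set
Pair n = Mat n n × Mat n n

_≈P_ : ∀ {n} → Pair n → Pair n → Set
(R , S) ≈P (R' , S') = (R ≈M R') × (S ≈M S')

infix 4 _≈P_

_·P_ : ∀ {n} → Pair n → Pair n → Pair n
(R , S) ·P (R' , S') = (R ·M R' , S ·M S')

idP : ∀ {n} → Pair n
idP = (idM , idM)

-- inverse in Mon_n({±1})^2 (inverse of a signed permutation matrix is its transpose)
invP : ∀ {n} → Pair n → Pair n
invP (R , S) = (transpose R , transpose S)

powP : ∀ {n} → Pair n → ℕ → Pair n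
powP σ zero    = idP
powP σ (suc j) = σ ·P powP σ j

IsAut : ∀ {n} → Mat n n → Pair n → Set
IsAut H (R , S) = IsSignedPerm R × IsSignedPerm S × (R ·M H ·M transpose S ≈M H)

IsStrongAut : ∀ {n} → Mat n n → Pair n → Set
IsStrongAut H σ = IsAut H σ × (proj₁ σ ≈M proj₂ σ)

HasOrder : ∀ {n} → Pair n → ℕ → Set
HasOrder σ m = (powP σ m ≈P idP) × (∀ j → 0 ℕ.< j → j ℕ.< m → ¬ (powP σ j ≈P idP))

data InGen {n} (σ₁ σ₂ : Pair n) : Pair n → Set where
  gen₁ : InGen σ₁ σ₂ σ₁
  gen₂ : InGen σ₁ σ₂ σ₂
  one  : InGen σ₁ σ₂ idP
  mul  : ∀ {τ τ'} → InGen σ₁ σ₂ τ → InGen σ₁ σ₂ τ' → InGen σ₁ σ₂ (τ ·P τ')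
  inv  : ∀ {τ} → InGen σ₁ σ₂ τ → InGen σ₁ σ₂ (invP τ)
  resp : ∀ {τ τ'} → τ ≈P τ' → InGen σ₁ σ₂ τ → InGen σ₁ σ₂ τ'

GenIsoDihedral : ∀ {n} → ℕ → Pair n → Pair n → Set
GenIsoDihedral {n} k σ₁ σ₂ =
  ∃ λ (φ : Fin (2 ℕ.* k) → Pair n) →
    (∀ g → InGen σ₁ σ₂ (φ g)) ×
    (∀ g h → φ (dmul k g h) ≈P φ g ·P φ h) ×
    (∀ g h → φ g ≈P φ h → g ≡ h) ×
    (∀ τ → InGen σ₁ σ₂ τ → ∃ λ g → φ g ≈P τ)

-- p_k: cycle (1,2,...,k), i.e. (0-indexed) i ↦ i+1 mod k
cycleK : ∀ {k} → Fin k → Fin k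
cycleK {suc m} i = (suc (toℕ i)) mod suc m

-- q_k: (2,k)(3,k-1)...((k+1)/2,(k+3)/2), i.e. (0-indexed) i ↦ -i mod k
reflK : ∀ {k} → Fin k → Fin k
reflK = negMod

pK : ∀ k → Mat k k
pK k = permMat (cycleK {k})

qK : ∀ k → Mat k k
qK k = permMat (reflK {k})

EK : ∀ k → Mat (2 ℕ.* k) (2 ℕ.* k)
EK k = diagBlocks 2 (pK k)

KK : ∀ k → Mat (2 ℕ.* k) (2 ℕ.* k)
KK k = antiDiagBlocks 2 (qK k)

FK : ∀ k → Mat (4 ℕ.+ 4 ℕ.* (2 ℕ.* k)) (4 ℕ.+ 4 ℕ.* (2 ℕ.* k))
FK k = directSum (idM {4}) (diagBlocks 4 (EK k))

LK : ∀ k → Mat (4 ℕ.+ 4 ℕ.* (2 ℕ.* k)) (4 ℕ.+ 4 ℕ.* (2 ℕ.* k))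
LK k = directSum (idM {4}) (diagBlocks 4 (KK k))

{-# OPTIONS --safe #-}
module Submission where

open import Defs
open import Data.Nat using (ℕ; _≤_; _+_; _*_)
open import Data.Bool using (Bool)
open import Data.Fin using (Fin)
open import Data.Product using (_×_; ∃; _,_)
open import Relation.Binary.PropositionalEquality using (_≡_)

open import Algebra.Bundles using (AbelianGroup; Group)
open import Algebra.Consequences.Propositional using (comm∧idˡ⇒id; comm∧invʳ⇒inv)
open import Algebra.Morphism.Structures using (IsGroupMonomorphism)
open import Algebra.Structures using (IsGroup; IsAbelianGroup)
import Algebra.Morphism.GroupMonomorphism as GroupMonomorphism
import Algebra.Properties.AbelianGroup as AbelianGroupProperties
import Algebra.Properties.Group as GroupProperties
open import Data.Bool using (if_then_else_)
open import Data.Empty using (⊥-elim)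
open import Data.Fin using (zero; suc; toℕ; _≟_; splitAt; remQuot; quotRem; combine; opposite)
open import Data.Fin.Properties using (+↔⊎; *↔×)
import Data.Fin.Properties as Fin
open import Data.Integer as ℤ using (ℤ; +_; -_)
import Data.Integer.Properties as ℤ
open import Data.Nat using (zero; suc; _∸_; _%_; _<_; s≤s)
import Data.Nat as ℕ
open import Data.Nat.DivMod using (_mod_; %-distribˡ-+; m%n%n≡m%n; m<n⇒m%n≡m; n%n≡0)
import Data.Nat.Properties as ℕ
open import Data.Product using (proj₁; proj₂; uncurry)
import Data.Product as Product
import Data.Product.Properties as Product
open import Data.Sum using (_⊎_; inj₁; inj₂)
import Data.Sum as Sum
import Data.Sum.Properties as Sum
open import Function using (_∘_; id; _⇔_; _↔_; Inverse; mk⇔)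
import Function.Properties.Equivalence as ⇔
open import Level using (0ℓ)
open import Relation.Binary.PropositionalEquality
  using (_≢_; _≗_; refl; sym; trans; cong; cong₂; subst; module ≡-Reasoning)
open import Relation.Binary.PropositionalEquality.Algebra using (isMagma)
open import Relation.Nullary using (Dec; yes; no; ¬_; _×-dec_)
open import Relation.Nullary.Decidable using (⌊_⌋; isYes≗does; does-⇔)

-- F and L are Ψ x and Ψ y, where Ψ g = diag(I₄, λ(g), λ(g), λ(g), λ(g)) and λ(g) is the
-- permutation matrix of left multiplication u ↦ g u on D₂ₖ. Left multiplication commutes with
-- the right regular representation, since (g u) h = g v iff u h = v, so permuting rows and
-- columns simultaneously by it fixes ρ(a), ρ(b), ρ(c), ρ(d) and hence H: every (Ψ g , Ψ g) is a
-- strong automorphism. The map g ↦ Ψ g is injective and reverses products, so g ↦ Ψ (g⁻¹)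
-- embeds D₂ₖ into Aut(H); its image is generated by the images of x and y, whose orders are
-- k and 2.

private variable
  A B X : Set
  m n p q : ℕ

⌊⌋-⇔ : A ⇔ B → (a? : Dec A) (b? : Dec B) → ⌊ a? ⌋ ≡ ⌊ b? ⌋
⌊⌋-⇔ A⇔B a? b? = trans (isYes≗does a?) (trans (does-⇔ A⇔B a? b?) (sym (isYes≗does b?)))

b2z-yes : (a? : Dec A) → A → b2z ⌊ a? ⌋ ≡ + 1
b2z-yes (yes _) _ = refl
b2z-yes (no ¬a) a = ⊥-elim (¬a a)

b2z-no : (a? : Dec A) → ¬ A → b2z ⌊ a? ⌋ ≡ + 0
b2z-no (yes a) ¬a = ⊥-elim (¬a a)
b2z-no (no _)  _  = refl

b2z≡1⇒ : (a? : Dec A) → b2z ⌊ a? ⌋ ≡ + 1 → A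
b2z≡1⇒ (yes a) _ = a

if-b2z : (a? : Dec A) (b? : Dec B) → (if ⌊ a? ⌋ then b2z ⌊ b? ⌋ else + 0) ≡ b2z ⌊ a? ×-dec b? ⌋
if-b2z (yes _) (yes _) = refl
if-b2z (yes _) (no _)  = refl
if-b2z (no _)  _       = refl

∑-cong : {f g : Fin n → ℤ} → f ≗ g → ∑ f ≡ ∑ g
∑-cong {zero}  f≗g = refl
∑-cong {suc n} f≗g = cong₂ ℤ._+_ (f≗g zero) (∑-cong (f≗g ∘ suc))

∑-zeros : ∑ {n} (λ _ → + 0) ≡ + 0
∑-zeros {zero}  = refl
∑-zeros {suc n} = trans (ℤ.+-identityˡ _) (∑-zeros {n})

∑-select : (p : Fin n) (f : Fin n → ℤ) → ∑ (λ l → b2z ⌊ l ≟ p ⌋ ℤ.* f l) ≡ f p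
∑-select {suc n} zero f = begin
  + 1 ℤ.* f zero ℤ.+ ∑ (λ l → + 0 ℤ.* f (suc l))
    ≡⟨ cong₂ ℤ._+_ (ℤ.*-identityˡ (f zero)) (∑-cong (λ l → ℤ.*-zeroˡ (f (suc l)))) ⟩
  f zero ℤ.+ ∑ {n} (λ _ → + 0)
    ≡⟨ cong (λ z → f zero ℤ.+ z) (∑-zeros {n}) ⟩
  f zero ℤ.+ + 0
    ≡⟨ ℤ.+-identityʳ (f zero) ⟩
  f zero ∎
  where open ≡-Reasoning
∑-select {suc n} (suc p) f = begin
  + 0 ℤ.* f zero ℤ.+ ∑ (λ l → b2z ⌊ suc l ≟ suc p ⌋ ℤ.* f (suc l))
    ≡⟨ cong₂ ℤ._+_ (ℤ.*-zeroˡ (f zero)) (∑-cong summand) ⟩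
  + 0 ℤ.+ ∑ (λ l → b2z ⌊ l ≟ p ⌋ ℤ.* f (suc l))
    ≡⟨ ℤ.+-identityˡ _ ⟩
  ∑ (λ l → b2z ⌊ l ≟ p ⌋ ℤ.* f (suc l))
    ≡⟨ ∑-select p (f ∘ suc) ⟩
  f (suc p) ∎
  where
  open ≡-Reasoning
  summand : ∀ l → b2z ⌊ suc l ≟ suc p ⌋ ℤ.* f (suc l) ≡ b2z ⌊ l ≟ p ⌋ ℤ.* f (suc l)
  summand l = cong (λ t → b2z t ℤ.* f (suc l))
                   (⌊⌋-⇔ (mk⇔ Fin.suc-injective (cong suc)) (suc l ≟ suc p) (l ≟ p))

≈M-sym : {M N : Mat m n} → M ≈M N → N ≈M M
≈M-sym M≈N i j = sym (M≈N i j)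

≈M-trans : {M N O : Mat m n} → M ≈M N → N ≈M O → M ≈M O
≈M-trans M≈N N≈O i j = trans (M≈N i j) (N≈O i j)

·M-cong : {M M′ : Mat m n} {N N′ : Mat n p} → M ≈M M′ → N ≈M N′ → M ·M N ≈M M′ ·M N′
·M-cong M≈M′ N≈N′ i j = ∑-cong (λ l → cong₂ ℤ._*_ (M≈M′ i l) (N≈N′ l j))

≈P-trans : {σ τ υ : Pair n} → σ ≈P τ → τ ≈P υ → σ ≈P υ
≈P-trans (R≈ , S≈) (R′≈ , S′≈) = ≈M-trans R≈ R′≈ , ≈M-trans S≈ S′≈

·P-cong : {σ σ′ τ τ′ : Pair n} → σ ≈P σ′ → τ ≈P τ′ → σ ·P τ ≈P σ′ ·P τ′
·P-cong (R≈ , S≈) (R′≈ , S′≈) = ·M-cong R≈ R′≈ , ·M-cong S≈ S′≈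

invP-cong : {σ τ : Pair n} → σ ≈P τ → invP σ ≈P invP τ
invP-cong (R≈ , S≈) = (λ i j → R≈ j i) , (λ i j → S≈ j i)

Invariant : (Fin n → Fin n) → Mat n n → Set
Invariant σ H = ∀ i j → H (σ i) (σ j) ≡ H i j

permMat-·M : (σ : Fin n → Fin n) (M : Mat n m) → permMat σ ·M M ≈M (λ i j → M (σ i) j)
permMat-·M σ M i j = ∑-select (σ i) (λ l → M l j)

·M-permMatᵀ : (M : Mat m n) (σ : Fin n → Fin n) → M ·M transpose (permMat σ) ≈M (λ i j → M i (σ j))
·M-permMatᵀ M σ i j = trans (∑-cong (λ l → ℤ.*-comm (M i l) _)) (∑-select (σ j) (M i))

permMat-∘ : (σ τ : Fin n → Fin n) → permMat σ ·M permMat τ ≈M permMat (τ ∘ σ)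
permMat-∘ σ τ = permMat-·M σ (permMat τ)

permMat-id : permMat id ≈M idM {n}
permMat-id i j = cong b2z (⌊⌋-⇔ (mk⇔ sym sym) (j ≟ i) (i ≟ j))

permMat-cong : {σ τ : Fin n → Fin n} → σ ≗ τ → permMat σ ≈M permMat τ
permMat-cong σ≗τ i j = cong (λ t → b2z ⌊ j ≟ t ⌋) (σ≗τ i)

permMat-injective : {σ τ : Fin n → Fin n} → permMat σ ≈M permMat τ → σ ≗ τ
permMat-injective {σ = σ} {τ} Pσ≈Pτ i =
  b2z≡1⇒ (σ i ≟ τ i) (trans (sym (Pσ≈Pτ i (σ i))) (b2z-yes (σ i ≟ σ i) refl))

permMat-conjugate : (σ : Fin n → Fin n) (H : Mat n n) →
                    permMat σ ·M H ·M transpose (permMat σ) ≈M (λ i j → H (σ i) (σ j))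
permMat-conjugate σ H = ≈M-trans (·M-cong (permMat-·M σ H) (λ _ _ → refl))
                                 (·M-permMatᵀ (λ i j → H (σ i) j) σ)

IsSignedPerm-resp : {M N : Mat n n} → M ≈M N → IsSignedPerm M → IsSignedPerm N
IsSignedPerm-resp {M = M} {N} M≈N (rows , cols) =
  (λ i → let (j , ±1 , zeros) = rows i in
         j , ±1-resp i j ±1 , λ j′ j′≢j → zero-resp i j′ (zeros j′ j′≢j)) ,
  (λ j → let (i , ±1 , zeros) = cols j in
         i , ±1-resp i j ±1 , λ i′ i′≢i → zero-resp i′ j (zeros i′ i′≢i))
  where
  ±1-resp : ∀ i j → M i j ≡ + 1 ⊎ M i j ≡ - + 1 → N i j ≡ + 1 ⊎ N i j ≡ - + 1
  ±1-resp i j = Sum.map (trans (sym (M≈N i j))) (trans (sym (M≈N i j)))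
  zero-resp : ∀ i j → M i j ≡ + 0 → N i j ≡ + 0
  zero-resp i j = trans (sym (M≈N i j))

module _ {σ τ : Fin n → Fin n} (τσ≗id : τ ∘ σ ≗ id) (στ≗id : σ ∘ τ ≗ id) where

  permMat-transpose : transpose (permMat σ) ≈M permMat τ
  permMat-transpose i j = cong b2z (⌊⌋-⇔
    (mk⇔ (λ i≡σj → trans (sym (τσ≗id j)) (cong τ (sym i≡σj)))
         (λ j≡τi → trans (sym (στ≗id i)) (cong σ (sym j≡τi))))
    (i ≟ σ j) (j ≟ τ i))

  permMat-isSignedPerm : IsSignedPerm (permMat σ)
  permMat-isSignedPerm =
    (λ i → σ i , inj₁ (b2z-yes (σ i ≟ σ i) refl) , λ j j≢σi → b2z-no (j ≟ σ i) j≢σi) ,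
    (λ j → τ j , inj₁ (b2z-yes (j ≟ σ (τ j)) (sym (στ≗id j))) ,
           λ i i≢τj → b2z-no (j ≟ σ i)
                               (λ j≡σi → i≢τj (trans (sym (τσ≗id i)) (cong τ (sym j≡σi)))))

  permMat-isStrongAut : {H R : Mat n n} → R ≈M permMat σ → Invariant σ H → IsStrongAut H (R , R)
  permMat-isStrongAut {H} {R} R≈P H-inv = (R-signed , R-signed , RHRᵀ≈H) , (λ _ _ → refl)
    where
    R-signed : IsSignedPerm R
    R-signed = IsSignedPerm-resp (≈M-sym R≈P) permMat-isSignedPerm
    RHRᵀ≈H : R ·M H ·M transpose R ≈M H
    RHRᵀ≈H = ≈M-trans (·M-cong (·M-cong R≈P λ _ _ → refl) (λ i j → R≈P j i))
                      (≈M-trans (permMat-conjugate σ H) H-inv)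

module _ (ι : Fin n ↔ X) where
  open Inverse ι

  relabel : (X → X) → Fin n → Fin n
  relabel f = from ∘ f ∘ to

  relabel-cong : {f g : X → X} → f ≗ g → relabel f ≗ relabel g
  relabel-cong f≗g r = cong from (f≗g (to r))

  relabel-∘ : (f g : X → X) → relabel (f ∘ g) ≗ relabel f ∘ relabel g
  relabel-∘ f g r = cong (from ∘ f) (sym (strictlyInverseˡ (g (to r))))

  relabel-id : relabel id ≗ id
  relabel-id = strictlyInverseʳ

  to-relabel : (f : X → X) → to ∘ relabel f ≗ f ∘ to
  to-relabel f r = strictlyInverseˡ (f (to r))

  relabel-injective : {f g : X → X} → relabel f ≗ relabel g → f ≗ g
  relabel-injective {f} {g} eq x = begin
    f x                     ≡⟨ cong f (strictlyInverseˡ x) ⟨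
    f (to (from x))         ≡⟨ to-relabel f (from x) ⟨
    to (relabel f (from x)) ≡⟨ cong to (eq (from x)) ⟩
    to (relabel g (from x)) ≡⟨ to-relabel g (from x) ⟩
    g (to (from x))         ≡⟨ cong g (strictlyInverseˡ x) ⟩
    g x                     ∎
    where open ≡-Reasoning

  permMat-relabel : (f : X → X) (r c : Fin n) {P : Set} (P? : Dec P) → to c ≡ f (to r) ⇔ P →
                    permMat (relabel f) r c ≡ b2z ⌊ P? ⌋
  permMat-relabel f r c P? ⇔P = cong b2z (⌊⌋-⇔ (⇔.trans c≡from⇔to≡ ⇔P) (c ≟ relabel f r) P?)
    where
    c≡from⇔to≡ : c ≡ from (f (to r)) ⇔ to c ≡ f (to r)
    c≡from⇔to≡ = mk⇔ (λ c≡ → trans (cong to c≡) (strictlyInverseˡ _))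
                     (λ to≡ → trans (sym (strictlyInverseʳ c)) (cong from to≡))

directSum-permMat : {Y : Mat p p} {Z : Mat q q} {σ : Fin p → Fin p} {τ : Fin q → Fin q} →
                    Y ≈M permMat σ → Z ≈M permMat τ →
                    directSum Y Z ≈M permMat (relabel (+↔⊎ {p}) (Sum.map σ τ))
directSum-permMat {p} {q} {Y} {Z} {σ} {τ} Y≈ Z≈ r c =
  trans entry (sym (permMat-relabel +↔⊎ (Sum.map σ τ) r c (Sum.≡-dec _≟_ _≟_ _ _) ⇔.refl))
  where
  entry : directSum Y Z r c ≡ b2z ⌊ Sum.≡-dec _≟_ _≟_ (splitAt p c) (Sum.map σ τ (splitAt p r)) ⌋
  entry with splitAt p r | splitAt p c
  ... | inj₁ i | inj₁ j = trans (Y≈ i j) (cong b2z (⌊⌋-⇔ (mk⇔ (cong inj₁) Sum.inj₁-injective) _ _))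
  ... | inj₁ _ | inj₂ _ = refl
  ... | inj₂ _ | inj₁ _ = refl
  ... | inj₂ i | inj₂ j = trans (Z≈ i j) (cong b2z (⌊⌋-⇔ (mk⇔ (cong inj₂) Sum.inj₂-injective) _ _))

module _ {n m : ℕ} (β : Fin n → Fin n) (f : Fin m → Fin m) (r c : Fin (n * m)) where
  private
    b b′ : Fin n
    b  = proj₁ (remQuot {n} m r)
    b′ = proj₁ (remQuot {n} m c)
    i j : Fin m
    i = proj₂ (remQuot {n} m r)
    j = proj₂ (remQuot {n} m c)

  permMat-blocks : permMat (relabel (*↔× {n}) (Product.map β f)) r c ≡
                   (if ⌊ b′ ≟ β b ⌋ then permMat f i j else + 0)
  permMat-blocks = trans
    (permMat-relabel *↔× (Product.map β f) r c ((b′ ≟ β b) ×-dec (j ≟ f i))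
                     (mk⇔ Product.,-injective (uncurry (cong₂ _,_))))
    (sym (if-b2z (b′ ≟ β b) (j ≟ f i)))

-- Case splits use quotRem rather than remQuot: remQuot unfolds to swap ∘ quotRem, so
-- with-abstracting remQuot would miss its occurrences inside diagBlocks, antiDiagBlocks, dmul.
diagBlocks-permMat : {Y : Mat m m} {f : Fin m → Fin m} → Y ≈M permMat f →
                     diagBlocks n Y ≈M permMat (relabel (*↔× {n}) (Product.map₂ f))
diagBlocks-permMat {m} {n} {Y} {f} Y≈ r c = trans entry (sym (permMat-blocks {n} id f r c))
  where
  entry : diagBlocks n Y r c ≡
          (if ⌊ proj₁ (remQuot {n} m c) ≟ proj₁ (remQuot {n} m r) ⌋
           then permMat f (proj₂ (remQuot {n} m r)) (proj₂ (remQuot {n} m c)) else + 0)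
  entry with quotRem {n} m r | quotRem {n} m c
  ... | (i , b) | (j , b′) =
    cong₂ (λ t z → if t then z else + 0) (⌊⌋-⇔ (mk⇔ sym sym) (b ≟ b′) (b′ ≟ b)) (Y≈ i j)

opposite-⇔ : (b b′ : Fin (suc n)) → toℕ b + toℕ b′ ≡ n ⇔ b′ ≡ opposite b
opposite-⇔ {n} b b′ = mk⇔
  (λ sum≡n → Fin.toℕ-injective (begin
    toℕ b′                   ≡⟨ ℕ.m+n∸m≡n (toℕ b) (toℕ b′) ⟨
    toℕ b + toℕ b′ ∸ toℕ b   ≡⟨ cong (_∸ toℕ b) sum≡n ⟩
    n ∸ toℕ b                ≡⟨ Fin.opposite-prop b ⟨
    toℕ (opposite b)         ∎))
  (λ b′≡ob → begin
    toℕ b + toℕ b′           ≡⟨ cong (λ t → toℕ b + toℕ t) b′≡ob ⟩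
    toℕ b + toℕ (opposite b) ≡⟨ cong (λ t → toℕ b + t) (Fin.opposite-prop b) ⟩
    toℕ b + (n ∸ toℕ b)      ≡⟨ ℕ.m+[n∸m]≡n (Fin.toℕ≤pred[n] b) ⟩
    n                        ∎)
  where open ≡-Reasoning

≡ᵇ-opposite : (b b′ : Fin n) → (toℕ b + toℕ b′ ℕ.≡ᵇ n ∸ 1) ≡ ⌊ b′ ≟ opposite b ⌋
≡ᵇ-opposite {suc n} b b′ =
  trans (sym (isYes≗does (toℕ b + toℕ b′ ℕ.≟ n))) (⌊⌋-⇔ (opposite-⇔ b b′) _ _)

antiDiagBlocks-permMat : {Y : Mat m m} {f : Fin m → Fin m} → Y ≈M permMat f →
                         antiDiagBlocks n Y ≈M permMat (relabel (*↔× {n}) (Product.map opposite f))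
antiDiagBlocks-permMat {m} {n} {Y} {f} Y≈ r c = trans entry (sym (permMat-blocks {n} opposite f r c))
  where
  entry : antiDiagBlocks n Y r c ≡
          (if ⌊ proj₁ (remQuot {n} m c) ≟ opposite (proj₁ (remQuot {n} m r)) ⌋
           then permMat f (proj₂ (remQuot {n} m r)) (proj₂ (remQuot {n} m c)) else + 0)
  entry with quotRem {n} m r | quotRem {n} m c
  ... | (i , b) | (j , b′) = cong₂ (λ t z → if t then z else + 0) (≡ᵇ-opposite b b′) (Y≈ i j)

module _ {m : ℕ} where
  private
    ι₁ : Fin (4 + 4 * m) ↔ (Fin 4 ⊎ Fin (4 * m))
    ι₁ = +↔⊎ {4}
    ι₂ : Fin (4 * m) ↔ (Fin 4 × Fin m)
    ι₂ = *↔× {4}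
    map₂-∘ : {Y Z W : Set} (h : Z → W) (g : Y → Z) →
             Sum.map₂ {A = Fin 4} (h ∘ g) ≗ Sum.map₂ h ∘ Sum.map₂ g
    map₂-∘ h g z = sym (Sum.map-map {f = id} {g = g} {f′ = id} {g′ = h} z)

  inBlocks : (Fin m → Fin m) → Fin (4 + 4 * m) → Fin (4 + 4 * m)
  inBlocks f = relabel ι₁ (Sum.map₂ (relabel ι₂ (Product.map₂ f)))

  inBlocks-cong : {f g : Fin m → Fin m} → f ≗ g → inBlocks f ≗ inBlocks g
  inBlocks-cong f≗g = relabel-cong ι₁ (Sum.map₂-cong (relabel-cong ι₂ (λ (b , u) → cong (b ,_) (f≗g u))))

  inBlocks-∘ : (f g : Fin m → Fin m) → inBlocks (f ∘ g) ≗ inBlocks f ∘ inBlocks g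
  inBlocks-∘ f g r = begin
    inBlocks (f ∘ g) r
      ≡⟨ relabel-cong ι₁ (Sum.map₂-cong (relabel-∘ ι₂ (Product.map₂ f) (Product.map₂ g))) r ⟩
    relabel ι₁ (Sum.map₂ (F ∘ G)) r
      ≡⟨ relabel-cong ι₁ (map₂-∘ F G) r ⟩
    relabel ι₁ (Sum.map₂ F ∘ Sum.map₂ G) r
      ≡⟨ relabel-∘ ι₁ (Sum.map₂ F) (Sum.map₂ G) r ⟩
    inBlocks f (inBlocks g r) ∎
    where
    open ≡-Reasoning
    F G : Fin (4 * m) → Fin (4 * m)
    F = relabel ι₂ (Product.map₂ f)
    G = relabel ι₂ (Product.map₂ g)

  inBlocks-id : inBlocks id ≗ id
  inBlocks-id r = begin
    inBlocks id r              ≡⟨ relabel-cong ι₁ (Sum.map₂-cong (relabel-id ι₂)) r ⟩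
    relabel ι₁ (Sum.map₂ id) r ≡⟨ relabel-cong ι₁ Sum.map-id r ⟩
    relabel ι₁ id r            ≡⟨ relabel-id ι₁ r ⟩
    r                          ∎
    where open ≡-Reasoning

  inBlocks-injective : {f g : Fin m → Fin m} → inBlocks f ≗ inBlocks g → f ≗ g
  inBlocks-injective {f} {g} inBf≗inBg u =
    cong proj₂ (relabel-injective ι₂ {Product.map₂ f} {Product.map₂ g} F≗G (zero , u))
    where
    F≗G : relabel ι₂ (Product.map₂ f) ≗ relabel ι₂ (Product.map₂ g)
    F≗G = Sum.inj₂-injective ∘ relabel-injective ι₁ {Sum.map₂ _} {Sum.map₂ _} inBf≗inBg ∘ inj₂

  permMat-inBlocks : {Y : Mat m m} {f : Fin m → Fin m} → Y ≈M permMat f →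
                     directSum (idM {4}) (diagBlocks 4 Y) ≈M permMat (inBlocks f)
  permMat-inBlocks Y≈ = directSum-permMat (≈M-sym permMat-id) (diagBlocks-permMat {n = 4} Y≈)

  blockIndex : Fin (4 + 4 * m) → Fin 4 ⊎ Fin 4 × Fin m
  blockIndex = Sum.map₂ (remQuot m) ∘ splitAt 4

  blockIndex-inBlocks : (f : Fin m → Fin m) →
                        blockIndex ∘ inBlocks f ≗ Sum.map₂ (Product.map₂ f) ∘ blockIndex
  blockIndex-inBlocks f r = begin
    Sum.map₂ (remQuot m) (splitAt 4 (inBlocks f r))
      ≡⟨ cong (Sum.map₂ (remQuot m)) (to-relabel ι₁ (Sum.map₂ G) r) ⟩
    Sum.map₂ (remQuot m) (Sum.map₂ G (splitAt 4 r))
      ≡⟨ map₂-∘ (remQuot m) G (splitAt 4 r) ⟨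
    Sum.map₂ (remQuot m ∘ G) (splitAt 4 r)
      ≡⟨ Sum.map₂-cong (to-relabel ι₂ (Product.map₂ f)) (splitAt 4 r) ⟩
    Sum.map₂ (Product.map₂ f ∘ remQuot m) (splitAt 4 r)
      ≡⟨ map₂-∘ (Product.map₂ f) (remQuot m) (splitAt 4 r) ⟩
    Sum.map₂ (Product.map₂ f) (blockIndex r) ∎
    where
    open ≡-Reasoning
    G : Fin (4 * m) → Fin (4 * m)
    G = relabel ι₂ (Product.map₂ f)

module _ {f : Fin m → Fin m} {A B C D : Mat m m}
         (A-inv : Invariant f A) (B-inv : Invariant f B) (C-inv : Invariant f C) (D-inv : Invariant f D)
         where

  private
    negM-invariant : {Y : Mat m m} → Invariant f Y → Invariant f (negM Y)
    negM-invariant Y-inv u v = cong -_ (Y-inv u v)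

  blockArr-invariant : ∀ bi bj → Invariant f (blockArr A B C D bi bj)
  blockArr-invariant zero                   zero                   = A-inv
  blockArr-invariant zero                   (suc zero)             = B-inv
  blockArr-invariant zero                   (suc (suc zero))       = C-inv
  blockArr-invariant zero                   (suc (suc (suc zero))) = D-inv
  blockArr-invariant (suc zero)             zero                   = negM-invariant B-inv
  blockArr-invariant (suc zero)             (suc zero)             = A-inv
  blockArr-invariant (suc zero)             (suc (suc zero))       = D-inv
  blockArr-invariant (suc zero)             (suc (suc (suc zero))) = negM-invariant C-inv
  blockArr-invariant (suc (suc zero))       zero                   = negM-invariant C-inv
  blockArr-invariant (suc (suc zero))       (suc zero)             = negM-invariant D-inv
  blockArr-invariant (suc (suc zero))       (suc (suc zero))       = A-inv
  blockArr-invariant (suc (suc zero))       (suc (suc (suc zero))) = B-inv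
  blockArr-invariant (suc (suc (suc zero))) zero                   = D-inv
  blockArr-invariant (suc (suc (suc zero))) (suc zero)             = negM-invariant C-inv
  blockArr-invariant (suc (suc (suc zero))) (suc (suc zero))       = B-inv
  blockArr-invariant (suc (suc (suc zero))) (suc (suc (suc zero))) = negM-invariant A-inv

  kimuraEntry : Fin 4 ⊎ Fin 4 × Fin m → Fin 4 ⊎ Fin 4 × Fin m → ℤ
  kimuraEntry (inj₁ i)        (inj₁ j)        = sgn (topLeft i j) (+ 1)
  kimuraEntry (inj₁ i)        (inj₂ (bj , _)) = sgn (topRight i bj) (+ 1)
  kimuraEntry (inj₂ (bi , _)) (inj₁ j)        = sgn (bottomLeft bi j) (+ 1)
  kimuraEntry (inj₂ (bi , u)) (inj₂ (bj , v)) = blockArr A B C D bi bj u v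

  kimuraAssemble-blockIndex : ∀ r c → kimuraAssemble A B C D r c ≡ kimuraEntry (blockIndex r) (blockIndex c)
  kimuraAssemble-blockIndex r c with splitAt 4 r | splitAt 4 c
  ... | inj₁ _ | inj₁ _ = refl
  ... | inj₁ _ | inj₂ _ = refl
  ... | inj₂ _ | inj₁ _ = refl
  ... | inj₂ _ | inj₂ _ = refl

  kimuraEntry-invariant : ∀ s t → kimuraEntry (Sum.map₂ (Product.map₂ f) s) (Sum.map₂ (Product.map₂ f) t)
                                  ≡ kimuraEntry s t
  kimuraEntry-invariant (inj₁ _)        (inj₁ _)        = refl
  kimuraEntry-invariant (inj₁ _)        (inj₂ _)        = refl
  kimuraEntry-invariant (inj₂ _)        (inj₁ _)        = refl
  kimuraEntry-invariant (inj₂ (bi , u)) (inj₂ (bj , v)) = blockArr-invariant bi bj u v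

  kimuraAssemble-invariant : Invariant (inBlocks f) (kimuraAssemble A B C D)
  kimuraAssemble-invariant r c = begin
    kimuraAssemble A B C D (inBlocks f r) (inBlocks f c)
      ≡⟨ kimuraAssemble-blockIndex (inBlocks f r) (inBlocks f c) ⟩
    kimuraEntry (blockIndex (inBlocks f r)) (blockIndex (inBlocks f c))
      ≡⟨ cong₂ kimuraEntry (blockIndex-inBlocks f r) (blockIndex-inBlocks f c) ⟩
    kimuraEntry (Sum.map₂ (Product.map₂ f) (blockIndex r)) (Sum.map₂ (Product.map₂ f) (blockIndex c))
      ≡⟨ kimuraEntry-invariant (blockIndex r) (blockIndex c) ⟩
    kimuraEntry (blockIndex r) (blockIndex c)
      ≡⟨ kimuraAssemble-blockIndex r c ⟨
    kimuraAssemble A B C D r c ∎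
    where open ≡-Reasoning

module Cyclic (n : ℕ) where
  k : ℕ
  k = suc n

  infixl 6 _⊕_
  _⊕_ : Fin k → Fin k → Fin k
  _⊕_ = addMod

  ⊖_ : Fin k → Fin k
  ⊖_ = negMod

  private
    toℕ-⊕ : ∀ a b → toℕ (a ⊕ b) ≡ (toℕ a + toℕ b) % k
    toℕ-⊕ a b = Fin.toℕ-fromℕ< _

    toℕ-mod : ∀ x → toℕ (x mod k) ≡ x % k
    toℕ-mod x = Fin.toℕ-fromℕ< _

    %-absorbˡ : ∀ x y → (x % k + y) % k ≡ (x + y) % k
    %-absorbˡ x y = begin
      (x % k + y) % k         ≡⟨ %-distribˡ-+ (x % k) y k ⟩
      (x % k % k + y % k) % k ≡⟨ cong (λ t → (t + y % k) % k) (m%n%n≡m%n x k) ⟩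
      (x % k + y % k) % k     ≡⟨ %-distribˡ-+ x y k ⟨
      (x + y) % k             ∎
      where open ≡-Reasoning

    %-absorbʳ : ∀ x y → (x + y % k) % k ≡ (x + y) % k
    %-absorbʳ x y = begin
      (x + y % k) % k ≡⟨ cong (_% k) (ℕ.+-comm x (y % k)) ⟩
      (y % k + x) % k ≡⟨ %-absorbˡ y x ⟩
      (y + x) % k     ≡⟨ cong (_% k) (ℕ.+-comm y x) ⟩
      (x + y) % k     ∎
      where open ≡-Reasoning

  ⊕-assoc : ∀ a b c → (a ⊕ b) ⊕ c ≡ a ⊕ (b ⊕ c)
  ⊕-assoc a b c = Fin.toℕ-injective (begin
    toℕ ((a ⊕ b) ⊕ c)                 ≡⟨ toℕ-⊕ (a ⊕ b) c ⟩
    (toℕ (a ⊕ b) + toℕ c) % k         ≡⟨ cong (λ t → (t + toℕ c) % k) (toℕ-⊕ a b) ⟩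
    ((toℕ a + toℕ b) % k + toℕ c) % k ≡⟨ %-absorbˡ (toℕ a + toℕ b) (toℕ c) ⟩
    (toℕ a + toℕ b + toℕ c) % k       ≡⟨ cong (_% k) (ℕ.+-assoc (toℕ a) (toℕ b) (toℕ c)) ⟩
    (toℕ a + (toℕ b + toℕ c)) % k     ≡⟨ %-absorbʳ (toℕ a) (toℕ b + toℕ c) ⟨
    (toℕ a + (toℕ b + toℕ c) % k) % k ≡⟨ cong (λ t → (toℕ a + t) % k) (toℕ-⊕ b c) ⟨
    (toℕ a + toℕ (b ⊕ c)) % k         ≡⟨ toℕ-⊕ a (b ⊕ c) ⟨
    toℕ (a ⊕ (b ⊕ c))                 ∎)
    where open ≡-Reasoning

  ⊕-comm : ∀ a b → a ⊕ b ≡ b ⊕ a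
  ⊕-comm a b = Fin.toℕ-injective (begin
    toℕ (a ⊕ b)         ≡⟨ toℕ-⊕ a b ⟩
    (toℕ a + toℕ b) % k ≡⟨ cong (_% k) (ℕ.+-comm (toℕ a) (toℕ b)) ⟩
    (toℕ b + toℕ a) % k ≡⟨ toℕ-⊕ b a ⟨
    toℕ (b ⊕ a)         ∎)
    where open ≡-Reasoning

  ⊕-identityˡ : ∀ a → zero ⊕ a ≡ a
  ⊕-identityˡ a = Fin.toℕ-injective (trans (toℕ-⊕ zero a) (m<n⇒m%n≡m (Fin.toℕ<n a)))

  ⊕-inverseʳ : ∀ a → a ⊕ ⊖ a ≡ zero
  ⊕-inverseʳ a = Fin.toℕ-injective (begin
    toℕ (a ⊕ ⊖ a)                 ≡⟨ toℕ-⊕ a (⊖ a) ⟩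
    (toℕ a + toℕ (⊖ a)) % k       ≡⟨ cong (λ t → (toℕ a + t) % k) (toℕ-mod (k ∸ toℕ a)) ⟩
    (toℕ a + (k ∸ toℕ a) % k) % k ≡⟨ %-absorbʳ (toℕ a) (k ∸ toℕ a) ⟩
    (toℕ a + (k ∸ toℕ a)) % k     ≡⟨ cong (_% k) (ℕ.m+[n∸m]≡n (ℕ.<⇒≤ (Fin.toℕ<n a))) ⟩
    k % k                         ≡⟨ n%n≡0 k ⟩
    0                             ∎)
    where open ≡-Reasoning

  ⊕-isAbelianGroup : IsAbelianGroup _≡_ _⊕_ zero ⊖_
  ⊕-isAbelianGroup = record
    { isGroup = record
      { isMonoid = record
        { isSemigroup = record { isMagma = isMagma _⊕_ ; assoc = ⊕-assoc }
        ; identity    = comm∧idˡ⇒id ⊕-comm ⊕-identityˡ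
        }
      ; inverse = comm∧invʳ⇒inv ⊕-comm ⊕-inverseʳ
      ; ⁻¹-cong = cong ⊖_
      }
    ; comm = ⊕-comm
    }

  cyclicGroup : AbelianGroup 0ℓ 0ℓ
  cyclicGroup = record { isAbelianGroup = ⊕-isAbelianGroup }

  mod-toℕ : ∀ a → toℕ a mod k ≡ a
  mod-toℕ a = Fin.toℕ-injective (trans (toℕ-mod (toℕ a)) (m<n⇒m%n≡m (Fin.toℕ<n a)))

  mod-+ : ∀ x y → (x mod k) ⊕ (y mod k) ≡ (x + y) mod k
  mod-+ x y = Fin.toℕ-injective (begin
    toℕ ((x mod k) ⊕ (y mod k))         ≡⟨ toℕ-⊕ (x mod k) (y mod k) ⟩
    (toℕ (x mod k) + toℕ (y mod k)) % k ≡⟨ cong₂ (λ a b → (a + b) % k) (toℕ-mod x) (toℕ-mod y) ⟩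
    (x % k + y % k) % k                 ≡⟨ %-distribˡ-+ x y k ⟨
    (x + y) % k                         ≡⟨ toℕ-mod (x + y) ⟨
    toℕ ((x + y) mod k)                 ∎)
    where open ≡-Reasoning

  mod-self : k mod k ≡ zero
  mod-self = Fin.toℕ-injective (trans (toℕ-mod k) (n%n≡0 k))

  mod≡zero⇒≡0 : ∀ {x} → x < k → x mod k ≡ zero → x ≡ 0
  mod≡zero⇒≡0 {x} x<k x-mod≡0 =
    trans (sym (m<n⇒m%n≡m x<k)) (trans (sym (toℕ-mod x)) (cong toℕ x-mod≡0))

  cycleK-⊕ : ∀ a → cycleK a ≡ (1 mod k) ⊕ a
  cycleK-⊕ a = trans (sym (mod-+ 1 (toℕ a))) (cong (λ b → (1 mod k) ⊕ b) (mod-toℕ a))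

module Dihedral (n : ℕ) where
  open Cyclic n

  private
    module ℤₖ where
      open AbelianGroup cyclicGroup public using (identityˡ; identityʳ; inverseˡ; inverseʳ)
      open AbelianGroupProperties cyclicGroup public using (⁻¹-∙-comm; ⁻¹-involutive; ε⁻¹≈ε)

  twist : Fin 2 → Fin k → Fin k
  twist zero       = id
  twist (suc zero) = ⊖_

  xor2-assoc : ∀ s t u → xor2 (xor2 s t) u ≡ xor2 s (xor2 t u)
  xor2-assoc zero       _          _          = refl
  xor2-assoc (suc zero) zero       _          = refl
  xor2-assoc (suc zero) (suc zero) zero       = refl
  xor2-assoc (suc zero) (suc zero) (suc zero) = refl

  xor2-identityʳ : ∀ s → xor2 s zero ≡ s
  xor2-identityʳ zero       = refl
  xor2-identityʳ (suc zero) = refl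

  xor2-self : ∀ s → xor2 s s ≡ zero
  xor2-self zero       = refl
  xor2-self (suc zero) = refl

  twist-⊕ : ∀ s a b → twist s (a ⊕ b) ≡ twist s a ⊕ twist s b
  twist-⊕ zero       a b = refl
  twist-⊕ (suc zero) a b = sym (ℤₖ.⁻¹-∙-comm a b)

  twist-xor2 : ∀ s t a → twist (xor2 s t) a ≡ twist s (twist t a)
  twist-xor2 zero       _          a = refl
  twist-xor2 (suc zero) zero       a = refl
  twist-xor2 (suc zero) (suc zero) a = sym (ℤₖ.⁻¹-involutive a)

  twist-involutive : ∀ s a → twist s (twist s a) ≡ a
  twist-involutive s a = trans (sym (twist-xor2 s s a)) (cong (λ t → twist t a) (xor2-self s))

  twist-⊖ : ∀ s a → twist s (⊖ a) ≡ ⊖ twist s a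
  twist-⊖ zero       a = refl
  twist-⊖ (suc zero) a = refl

  twist-zero : ∀ s → twist s zero ≡ zero
  twist-zero zero       = refl
  twist-zero (suc zero) = ℤₖ.ε⁻¹≈ε

  -- (s , i) stands for x^i y^s, which Defs stores at index elem s i.
  Coords : Set
  Coords = Fin 2 × Fin k

  elem : Fin 2 → Fin k → Fin (2 * k)
  elem = combine

  infixl 7 _·_
  _·_ : Coords → Coords → Coords
  (s , i) · (t , j) = xor2 s t , i ⊕ twist s j

  infix 8 _⁻¹ᶜ
  _⁻¹ᶜ : Coords → Coords
  (s , i) ⁻¹ᶜ = s , ⊖ twist s i

  ·-assoc : ∀ p q r → (p · q) · r ≡ p · (q · r)
  ·-assoc (s , i) (t , j) (u , l) = cong₂ _,_ (xor2-assoc s t u) (begin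
    (i ⊕ twist s j) ⊕ twist (xor2 s t) l  ≡⟨ cong (λ a → (i ⊕ twist s j) ⊕ a) (twist-xor2 s t l) ⟩
    (i ⊕ twist s j) ⊕ twist s (twist t l) ≡⟨ ⊕-assoc i (twist s j) (twist s (twist t l)) ⟩
    i ⊕ (twist s j ⊕ twist s (twist t l)) ≡⟨ cong (i ⊕_) (twist-⊕ s j (twist t l)) ⟨
    i ⊕ twist s (j ⊕ twist t l)           ∎)
    where open ≡-Reasoning

  ·-inverseʳ : ∀ p → p · p ⁻¹ᶜ ≡ (zero , zero)
  ·-inverseʳ (s , i) = cong₂ _,_ (xor2-self s) (begin
    i ⊕ twist s (⊖ twist s i) ≡⟨ cong (i ⊕_) (twist-⊖ s (twist s i)) ⟩
    i ⊕ ⊖ twist s (twist s i) ≡⟨ cong (λ a → i ⊕ ⊖ a) (twist-involutive s i) ⟩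
    i ⊕ ⊖ i                   ≡⟨ ℤₖ.inverseʳ i ⟩
    zero                      ∎)
    where open ≡-Reasoning

  ·-isGroup : IsGroup _≡_ _·_ (zero , zero) _⁻¹ᶜ
  ·-isGroup = record
    { isMonoid = record
      { isSemigroup = record { isMagma = isMagma _·_ ; assoc = ·-assoc }
      ; identity    = (λ (t , j) → cong (t ,_) (ℤₖ.identityˡ j))
                    , (λ (s , i) → cong₂ _,_ (xor2-identityʳ s)
                                             (trans (cong (i ⊕_) (twist-zero s)) (ℤₖ.identityʳ i)))
      }
    ; inverse = (λ (s , i) → cong₂ _,_ (xor2-self s) (ℤₖ.inverseˡ (twist s i))) , ·-inverseʳ
    ; ⁻¹-cong = cong _⁻¹ᶜ
    }

  dε : Fin (2 * k)
  dε = elem zero zero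

  dinv : Fin (2 * k) → Fin (2 * k)
  dinv u = uncurry elem (remQuot k u ⁻¹ᶜ)

  dmul-remQuot : ∀ u v → dmul k u v ≡ uncurry elem (remQuot k u · remQuot k v)
  dmul-remQuot u v with quotRem {2} k u | quotRem {2} k v
  ... | (_ , zero)     | _ = refl
  ... | (_ , suc zero) | _ = refl

  remQuot-elem : ∀ p → remQuot k (uncurry elem p) ≡ p
  remQuot-elem (s , i) = Fin.remQuot-combine s i

  private
    remQuot-isGroupMonomorphism :
      IsGroupMonomorphism (record { _≈_ = _≡_ ; _∙_ = dmul k ; ε = dε ; _⁻¹ = dinv })
                          (record { _≈_ = _≡_ ; _∙_ = _·_ ; ε = zero , zero ; _⁻¹ = _⁻¹ᶜ })
                          (remQuot k)
    remQuot-isGroupMonomorphism = record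
      { isGroupHomomorphism = record
        { isMonoidHomomorphism = record
          { isMagmaHomomorphism = record
            { isRelHomomorphism = record { cong = cong (remQuot k) }
            ; homo = λ u v → trans (cong (remQuot k) (dmul-remQuot u v)) (remQuot-elem _)
            }
          ; ε-homo = remQuot-elem (zero , zero)
          }
        ; ⁻¹-homo = λ u → remQuot-elem (remQuot k u ⁻¹ᶜ)
        }
      ; injective = λ {u} {v} eq →
          trans (sym (Fin.combine-remQuot k u)) (trans (cong (uncurry elem) eq) (Fin.combine-remQuot k v))
      }

  D₂ₖ : Group 0ℓ 0ℓ
  D₂ₖ = record { isGroup = GroupMonomorphism.isGroup remQuot-isGroupMonomorphism ·-isGroup }

  open Group D₂ₖ using (identityˡ)

  dmul-elem : ∀ s i t j → dmul k (elem s i) (elem t j) ≡ elem (xor2 s t) (i ⊕ twist s j)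
  dmul-elem s i t j = trans (dmul-remQuot (elem s i) (elem t j))
    (cong (uncurry elem) (cong₂ _·_ (remQuot-elem (s , i)) (remQuot-elem (t , j))))

  x y : Fin (2 * k)
  x = elem zero (1 mod k)
  y = elem (suc zero) zero

  infixr 8 _^_
  _^_ : Fin (2 * k) → ℕ → Fin (2 * k)
  g ^ zero  = dε
  g ^ suc m = dmul k (g ^ m) g

  x^m≡elem : ∀ m → x ^ m ≡ elem zero (m mod k)
  x^m≡elem zero    = refl
  x^m≡elem (suc m) = begin
    dmul k (x ^ m) x                  ≡⟨ cong (λ g → dmul k g x) (x^m≡elem m) ⟩
    dmul k (elem zero (m mod k)) x    ≡⟨ dmul-elem zero (m mod k) zero (1 mod k) ⟩
    elem zero ((m mod k) ⊕ (1 mod k)) ≡⟨ cong (elem zero) (mod-+ m 1) ⟩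
    elem zero ((m + 1) mod k)         ≡⟨ cong (λ a → elem zero (a mod k)) (ℕ.+-comm m 1) ⟩
    elem zero (suc m mod k)           ∎
    where open ≡-Reasoning

  x^k≡ε : x ^ k ≡ dε
  x^k≡ε = trans (x^m≡elem k) (cong (elem zero) mod-self)

  x^j≢ε : ∀ j → 0 < j → j < k → x ^ j ≢ dε
  x^j≢ε j 0<j j<k x^j≡ε = ℕ.<⇒≢ 0<j (sym (mod≡zero⇒≡0 j<k j-mod≡0))
    where
    j-mod≡0 : j mod k ≡ zero
    j-mod≡0 = Fin.combine-injectiveʳ {2} zero (j mod k) zero zero (trans (sym (x^m≡elem j)) x^j≡ε)

  y^2≡ε : y ^ 2 ≡ dε
  y^2≡ε = begin
    dmul k (dmul k dε y) y    ≡⟨ cong (λ g → dmul k g y) (identityˡ y) ⟩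
    dmul k y y                ≡⟨ dmul-elem (suc zero) zero (suc zero) zero ⟩
    elem zero (zero ⊕ ⊖ zero) ≡⟨ cong (elem zero) (ℤₖ.inverseʳ zero) ⟩
    dε                        ∎
    where open ≡-Reasoning

  y^j≢ε : ∀ j → 0 < j → j < 2 → y ^ j ≢ dε
  y^j≢ε (suc zero) _ _ y^1≡ε
    with Fin.combine-injectiveˡ {2} (suc zero) zero zero zero (trans (sym (identityˡ y)) y^1≡ε)
  ... | ()
  y^j≢ε (suc (suc _)) _ (s≤s (s≤s ()))

  normalForm : ∀ g → ∃ λ m → g ≡ x ^ m ⊎ g ≡ dmul k (x ^ m) y
  normalForm g = subst (λ h → ∃ λ m → h ≡ x ^ m ⊎ h ≡ dmul k (x ^ m) y) (Fin.combine-remQuot k g)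
                       (elem-normalForm (remQuot k g))
    where
    x^toℕ : ∀ i → x ^ toℕ i ≡ elem zero i
    x^toℕ i = trans (x^m≡elem (toℕ i)) (cong (elem zero) (mod-toℕ i))

    elem-normalForm : ∀ p → ∃ λ m → uncurry elem p ≡ x ^ m ⊎ uncurry elem p ≡ dmul k (x ^ m) y
    elem-normalForm (zero     , i) = toℕ i , inj₁ (sym (x^toℕ i))
    elem-normalForm (suc zero , i) = toℕ i , inj₂ (sym (begin
      dmul k (x ^ toℕ i) y       ≡⟨ cong (λ g → dmul k g y) (x^toℕ i) ⟩
      dmul k (elem zero i) y     ≡⟨ dmul-elem zero i (suc zero) zero ⟩
      elem (suc zero) (i ⊕ zero) ≡⟨ cong (elem (suc zero)) (ℤₖ.identityʳ i) ⟩
      elem (suc zero) i          ∎))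
      where open ≡-Reasoning

module Representation (n : ℕ) where
  open Cyclic n
  open Dihedral n
  open Group D₂ₖ using (assoc; identityˡ; identityʳ; inverseˡ; inverseʳ)
  open GroupProperties D₂ₖ
    using (∙-cancelˡ; ⁻¹-involutive; ⁻¹-anti-homo-∙; ε⁻¹≈ε; ⁻¹-injective)

  N : ℕ
  N = 4 + 4 * (2 * k)

  π : Fin (2 * k) → Fin N → Fin N
  π g = inBlocks (dmul k g)

  Ψ : Fin (2 * k) → Mat N N
  Ψ g = permMat (π g)

  π-∙ : ∀ g h → π (dmul k g h) ≗ π g ∘ π h
  π-∙ g h r = trans (inBlocks-cong (assoc g h) r) (inBlocks-∘ (dmul k g) (dmul k h) r)

  π-ε : π dε ≗ id
  π-ε r = trans (inBlocks-cong identityˡ r) (inBlocks-id {2 * k} r)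

  π-inverseˡ : ∀ g → π (dinv g) ∘ π g ≗ id
  π-inverseˡ g r = trans (sym (π-∙ (dinv g) g r)) (trans (cong (λ h → π h r) (inverseˡ g)) (π-ε r))

  π-inverseʳ : ∀ g → π g ∘ π (dinv g) ≗ id
  π-inverseʳ g r = trans (sym (π-∙ g (dinv g) r)) (trans (cong (λ h → π h r) (inverseʳ g)) (π-ε r))

  Ψ-cong : ∀ {g h} → g ≡ h → Ψ g ≈M Ψ h
  Ψ-cong refl _ _ = refl

  Ψ-∙ : ∀ g h → Ψ g ·M Ψ h ≈M Ψ (dmul k h g)
  Ψ-∙ g h = ≈M-trans (permMat-∘ (π g) (π h)) (permMat-cong (λ r → sym (π-∙ h g r)))

  Ψ-ε : Ψ dε ≈M idM
  Ψ-ε = ≈M-trans (permMat-cong π-ε) permMat-id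

  Ψ-transpose : ∀ g → transpose (Ψ g) ≈M Ψ (dinv g)
  Ψ-transpose g = permMat-transpose {σ = π g} {π (dinv g)} (π-inverseˡ g) (π-inverseʳ g)

  Ψ-injective : ∀ {g h} → Ψ g ≈M Ψ h → g ≡ h
  Ψ-injective {g} {h} Ψg≈Ψh = begin
    g           ≡⟨ identityʳ g ⟨
    dmul k g dε ≡⟨ inBlocks-injective {f = dmul k g} {dmul k h} (permMat-injective Ψg≈Ψh) dε ⟩
    dmul k h dε ≡⟨ identityʳ h ⟩
    h           ∎
    where open ≡-Reasoning

  Ψ≈id⇒≡ε : ∀ {g} → Ψ g ≈M idM → g ≡ dε
  Ψ≈id⇒≡ε Ψg≈id = Ψ-injective (≈M-trans Ψg≈id (≈M-sym Ψ-ε))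

  ρ-invariant : ∀ g h → Invariant (dmul k g) (ρ k h)
  ρ-invariant g h u v = cong b2z (⌊⌋-⇔
    (mk⇔ (λ gu·h≡gv → ∙-cancelˡ g _ _ (trans (sym (assoc g u h)) gu·h≡gv))
         (λ uh≡v → trans (assoc g u h) (cong (dmul k g) uh≡v)))
    (dmul k (dmul k g u) h ≟ dmul k g v) (dmul k u h ≟ v))

  pmMat-invariant : ∀ g w → Invariant (dmul k g) (pmMat k w)
  pmMat-invariant g w u v =
    cong (λ z → + 2 ℤ.* z ℤ.- + 1)
         (∑-cong (λ h → cong (λ z → b2z (w h) ℤ.* z) (ρ-invariant g h u v)))

  Ψ-isStrongAut : ∀ {R} g a b c d → R ≈M Ψ g → IsStrongAut (kimuraH k a b c d) (R , R)
  Ψ-isStrongAut g a b c d R≈Ψg =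
    permMat-isStrongAut {σ = π g} {π (dinv g)} (π-inverseˡ g) (π-inverseʳ g) R≈Ψg
      (kimuraAssemble-invariant (pmMat-invariant g a) (pmMat-invariant g b)
                                (pmMat-invariant g c) (pmMat-invariant g d))

  powP-Ψ : ∀ {R g} → R ≈M Ψ g → ∀ j → powP (R , R) j ≈P (Ψ (g ^ j) , Ψ (g ^ j))
  powP-Ψ R≈Ψg zero = ≈M-sym Ψ-ε , ≈M-sym Ψ-ε
  powP-Ψ {g = g} R≈Ψg (suc j) =
    ≈P-trans (·P-cong (R≈Ψg , R≈Ψg) (powP-Ψ R≈Ψg j)) (Ψ-∙ g (g ^ j) , Ψ-∙ g (g ^ j))

  Ψ-hasOrder : ∀ {R m} g → R ≈M Ψ g → g ^ m ≡ dε → (∀ j → 0 < j → j < m → g ^ j ≢ dε) →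
               HasOrder (R , R) m
  Ψ-hasOrder {m = m} g R≈Ψg g^m≡ε g^j≢ε =
    ≈P-trans (powP-Ψ R≈Ψg m) (Ψg^m≈id , Ψg^m≈id) ,
    λ j 0<j j<m R^j≈id → g^j≢ε j 0<j j<m
      (Ψ≈id⇒≡ε (≈M-trans (≈M-sym (proj₁ (powP-Ψ R≈Ψg j))) (proj₁ R^j≈id)))
    where
    Ψg^m≈id : Ψ (g ^ m) ≈M idM
    Ψg^m≈id = ≈M-trans (Ψ-cong g^m≡ε) Ψ-ε

  relabel-dmul : ∀ q (f : Coords → Coords) → (∀ p → f p ≡ q · p) →
                 relabel (*↔× {2} {k}) f ≗ dmul k (uncurry elem q)
  relabel-dmul q f f≡q· u = begin
    uncurry elem (f (remQuot k u))
      ≡⟨ cong (uncurry elem) (f≡q· (remQuot k u)) ⟩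
    uncurry elem (q · remQuot k u)
      ≡⟨ cong (λ p → uncurry elem (p · remQuot k u)) (remQuot-elem q) ⟨
    uncurry elem (remQuot k (uncurry elem q) · remQuot k u)
      ≡⟨ dmul-remQuot (uncurry elem q) u ⟨
    dmul k (uncurry elem q) u ∎
    where open ≡-Reasoning

  F≈Ψx : FK k ≈M Ψ x
  F≈Ψx = ≈M-trans (permMat-inBlocks {f = rotate} E≈) (permMat-cong (inBlocks-cong {2 * k} rotate≗x·))
    where
    rotate : Fin (2 * k) → Fin (2 * k)
    rotate = relabel (*↔× {2} {k}) (Product.map₂ cycleK)
    E≈ : EK k ≈M permMat rotate
    E≈ = diagBlocks-permMat {k} {2} {pK k} {cycleK} (λ _ _ → refl)
    rotate≗x· : rotate ≗ dmul k x
    rotate≗x· = relabel-dmul (zero , 1 mod k) (Product.map₂ cycleK) (λ (s , i) → cong (s ,_) (cycleK-⊕ i))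

  L≈Ψy : LK k ≈M Ψ y
  L≈Ψy = ≈M-trans (permMat-inBlocks {f = reflect} K≈) (permMat-cong (inBlocks-cong {2 * k} reflect≗y·))
    where
    reflect : Fin (2 * k) → Fin (2 * k)
    reflect = relabel (*↔× {2} {k}) (Product.map opposite negMod)
    K≈ : KK k ≈M permMat reflect
    K≈ = antiDiagBlocks-permMat {k} {2} {qK k} {reflK} (λ _ _ → refl)
    opposite≡y· : ∀ p → Product.map opposite negMod p ≡ (suc zero , zero) · p
    opposite≡y· (zero     , i) = cong (suc zero ,_) (sym (⊕-identityˡ (⊖ i)))
    opposite≡y· (suc zero , i) = cong (zero ,_) (sym (⊕-identityˡ (⊖ i)))
    reflect≗y· : reflect ≗ dmul k y
    reflect≗y· = relabel-dmul (suc zero , zero) (Product.map opposite negMod) opposite≡y·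

  private
    Gen : Pair N → Set
    Gen = InGen (FK k , FK k) (LK k , LK k)

    powP-gen : ∀ j → Gen (powP (FK k , FK k) j)
    powP-gen zero    = one
    powP-gen (suc j) = mul gen₁ (powP-gen j)

  Ψx^m-gen : ∀ m → Gen (Ψ (x ^ m) , Ψ (x ^ m))
  Ψx^m-gen m = resp (powP-Ψ F≈Ψx m) (powP-gen m)

  Ψ-gen : ∀ g → Gen (Ψ g , Ψ g)
  Ψ-gen g with normalForm g
  ... | m , inj₁ refl = Ψx^m-gen m
  ... | m , inj₂ refl = resp (LΨx^m≈ , LΨx^m≈) (mul gen₂ (Ψx^m-gen m))
    where
    LΨx^m≈ : LK k ·M Ψ (x ^ m) ≈M Ψ (dmul k (x ^ m) y)
    LΨx^m≈ = ≈M-trans (·M-cong {N = Ψ (x ^ m)} L≈Ψy (λ _ _ → refl)) (Ψ-∙ y (x ^ m))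

  φ : Fin (2 * k) → Pair N
  φ g = Ψ (dinv g) , Ψ (dinv g)

  φ-∙ : ∀ g h → φ (dmul k g h) ≈P φ g ·P φ h
  φ-∙ g h = Ψ⁻¹-∙ , Ψ⁻¹-∙
    where
    Ψ⁻¹-∙ : Ψ (dinv (dmul k g h)) ≈M Ψ (dinv g) ·M Ψ (dinv h)
    Ψ⁻¹-∙ = ≈M-trans (Ψ-cong (⁻¹-anti-homo-∙ g h)) (≈M-sym (Ψ-∙ (dinv g) (dinv h)))

  φ-dinv : ∀ g → φ (dinv g) ≈P (Ψ g , Ψ g)
  φ-dinv g = Ψ-cong (⁻¹-involutive g) , Ψ-cong (⁻¹-involutive g)

  φ-ε : φ dε ≈P idP
  φ-ε = ≈M-trans (Ψ-cong ε⁻¹≈ε) Ψ-ε , ≈M-trans (Ψ-cong ε⁻¹≈ε) Ψ-ε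

  φ-inv : ∀ g → φ (dinv g) ≈P invP (φ g)
  φ-inv g = Ψ⁻¹ᵀ , Ψ⁻¹ᵀ
    where
    Ψ⁻¹ᵀ : Ψ (dinv (dinv g)) ≈M transpose (Ψ (dinv g))
    Ψ⁻¹ᵀ = ≈M-sym (Ψ-transpose (dinv g))

  φ-surjective : ∀ {τ} → Gen τ → ∃ λ g → φ g ≈P τ
  φ-surjective gen₁ = dinv x , ≈P-trans (φ-dinv x) (≈M-sym F≈Ψx , ≈M-sym F≈Ψx)
  φ-surjective gen₂ = dinv y , ≈P-trans (φ-dinv y) (≈M-sym L≈Ψy , ≈M-sym L≈Ψy)
  φ-surjective one  = dε , φ-ε
  φ-surjective (mul p q) with φ-surjective p | φ-surjective q
  ... | g , φg≈ | h , φh≈ = dmul k g h , ≈P-trans (φ-∙ g h) (·P-cong φg≈ φh≈)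
  φ-surjective (inv p) with φ-surjective p
  ... | g , φg≈ = dinv g , ≈P-trans (φ-inv g) (invP-cong φg≈)
  φ-surjective (resp τ≈ p) with φ-surjective p
  ... | g , φg≈ = g , ≈P-trans φg≈ τ≈

  genIsoDihedral : GenIsoDihedral k (FK k , FK k) (LK k , LK k)
  genIsoDihedral =
    φ ,
    (λ g → Ψ-gen (dinv g)) ,
    φ-∙ ,
    (λ g h φg≈φh → ⁻¹-injective (Ψ-injective (proj₁ φg≈φh))) ,
    (λ _ → φ-surjective)

proposition3p1 : (k : ℕ) → 3 ≤ k → (∃ λ m → k ≡ 2 * m + 1) →
    (a b c d : Fin (2 * k) → Bool) →
    IsHadamard (kimuraH k a b c d) →
      (IsStrongAut (kimuraH k a b c d) (FK k , FK k) × HasOrder (FK k , FK k) k) ×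
      (IsStrongAut (kimuraH k a b c d) (LK k , LK k) × HasOrder (LK k , LK k) 2) ×
      GenIsoDihedral k (FK k , FK k) (LK k , LK k)
proposition3p1 zero    ()
proposition3p1 (suc n) _ _ a b c d _ =
  (Ψ-isStrongAut x a b c d F≈Ψx , Ψ-hasOrder x F≈Ψx x^k≡ε x^j≢ε) ,
  (Ψ-isStrongAut y a b c d L≈Ψy , Ψ-hasOrder y L≈Ψy y^2≡ε y^j≢ε) ,
  genIsoDihedral
  where
  open Dihedral n
  open Representation n
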